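{- Let $\Phi=\mathrm{Q}_1S_1\cdots\mathrm{Q}_mS_m.\,\Phi_\ast$ be an SO sentence, where $\mathrm{Q}_i\in\{\exists,\forall\}$ and $S_i$ are second-order variables. The following are equivalent: (1) there is an $\exists$-guarded SO sentence $\mathrm{Q}_1S_1\cdots\mathrm{Q}_mS_m.\,\Psi_\exists$ logically equivalent to $\Phi$; (2) there is a $\forall$-restricted SO sentence $\overline{\mathrm{Q}}_1S_1\cdots\overline{\mathrm{Q}}_mS_m.\,\Psi_\forall$ logically equivalent to $\neg\Phi$, where $\overline{\mathrm{Q}}$ denotes the quantifier complementary to $\mathrm{Q}$.
   Context: SO formulas are over a finite relational signature with equality. A formula is normalized if it is prenex (SO quantifier prefix, FO quantifier prefix, quantifier-free part); CNF-/DNF-normalized if additionally the quantifier-free part is in CNF/DNF. A CNF-normalized SO sentence is $\exists$-guarded if for every clause $\phi$ and every universally quantified FO variable $x$ occurring in $\phi$, $\phi$ contains a disjunct $\neg S(\bar x)$ with $S$ an existentially quantified SO variable and $x$ an entry of $\bar x$. A DNF-normalized SO sentence is $\forall$-restricted if for every (conjunctive) clause $\phi$ and every existentially quantified FO variable $x$ occurring in $\phi$, $\phi$ contains a conjunct $S(\bar x)$ with $S$ a universally quantified SO variable and $x$ an entry of $\bar x$. A normalized sentence is $\exists$-guarded ($\forall$-restricted) if some CNF (DNF) obtained from its quantifier-free part via De Morgan's laws and distributivity witnesses the condition. The sets of $\exists$-guarded and of $\forall$-restricted SO sentences are the closures of the respective normalized sentences under internal conjunctions and disjunctions: from $\mathrm{Q}_1S_1\cdots\mathrm{Q}_nS_n.\phi_1$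 and $\mathrm{Q}_1S_1\cdots\mathrm{Q}_nS_n.\phi_2$ one may form $\mathrm{Q}_1S_1\cdots\mathrm{Q}_nS_n(\phi_1\wedge\phi_2)$ and $\mathrm{Q}_1S_1\cdots\mathrm{Q}_nS_n(\phi_1\vee\phi_2)$. Logical equivalence is over finite structures. -}

module Defs where

open import Data.Nat using (ℕ; zero; suc)
open import Data.Fin using (Fin; zero; suc)
open import Data.Bool using (Bool; true)
open import Data.List using (List; []; _∷_; length; lookup; map)
open import Data.List.Membership.Propositional using (_∈_)
open import Data.List.Relation.Unary.All as All using (All; []; _∷_)
open import Data.Vec using (Vec)
import Data.Vec as Vec
open import Data.Vec.Membership.Propositional renaming (_∈_ to _∈ᵥ_)
open import Data.Product using (Σ; _×_; _,_; proj₁; proj₂)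
open import Data.Sum using (_⊎_)
open import Relation.Nullary using (¬_)
open import Relation.Binary.PropositionalEquality using (_≡_)

-- A finite relational signature: the list of arities of its relation
-- symbols (symbol R : Fin (length σ) has arity lookup σ R).
Sig : Set
Sig = List ℕ

data Qu : Set where
  ∃q ∀q : Qu

flipQ : Qu → Qu
flipQ ∃q = ∀q
flipQ ∀q = ∃q

-- SO variables in scope, each tagged with the quantifier binding it and
-- its arity (head = innermost bound SO variable).
SOCtx : Set
SOCtx = List (Qu × ℕ)

-- An SO quantifier prefix Q₁S₁ ⋯ QₘSₘ, listed outermost first
-- (entry = quantifier and arity of Sᵢ).
SOPrefix : Set
SOPrefix = List (Qu × ℕ)

extend : SOCtx → SOPrefix → SOCtx
extend Γ []       = Γ
extend Γ (p ∷ P)  = extend (p ∷ Γ) P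

flipPrefix : SOPrefix → SOPrefix
flipPrefix = map (λ p → flipQ (proj₁ p) , proj₂ p)

module _ (σ : Sig) where

  -- SO formulas (FO variables as de Bruijn indices Fin n)

  data Fm : SOCtx → ℕ → Set where
    rel  : ∀ {Γ n} (R : Fin (length σ)) → Vec (Fin n) (lookup σ R) → Fm Γ n
    svar : ∀ {Γ n q k} → (q , k) ∈ Γ → Vec (Fin n) k → Fm Γ n
    eq   : ∀ {Γ n} → Fin n → Fin n → Fm Γ n
    neg  : ∀ {Γ n} → Fm Γ n → Fm Γ n
    and  : ∀ {Γ n} → Fm Γ n → Fm Γ n → Fm Γ n
    or   : ∀ {Γ n} → Fm Γ n → Fm Γ n → Fm Γ n
    foQ  : ∀ {Γ n} → Qu → Fm Γ (suc n) → Fm Γ n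
    soQ  : ∀ {Γ n} (q : Qu) (k : ℕ) → Fm ((q , k) ∷ Γ) n → Fm Γ n

  Sentence : Set
  Sentence = Fm [] 0

  bindSO : ∀ {Γ n} (P : SOPrefix) → Fm (extend Γ P) n → Fm Γ n
  bindSO []            φ = φ
  bindSO ((q , k) ∷ P) φ = soQ q k (bindSO P φ)

  record Structure : Set where
    field
      size   : ℕ     -- the domain is Fin (suc size)
      interp : (R : Fin (length σ)) → Vec (Fin (suc size)) (lookup σ R) → Bool

  module _ (M : Structure) where
    open Structure M

    Dom : Set
    Dom = Fin (suc size)

    Rel : ℕ → Set
    Rel k = Vec Dom k → Bool

    SOEnv : SOCtx → Set
    SOEnv Γ = All (λ p → Rel (proj₂ p)) Γ

    _▸_ : ∀ {n} → Dom → (Fin n → Dom) → Fin (suc n) → Dom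
    (a ▸ ρ) zero    = a
    (a ▸ ρ) (suc i) = ρ i

    Sat : ∀ {Γ n} → SOEnv Γ → (Fin n → Dom) → Fm Γ n → Set
    Sat η ρ (rel R xs)   = interp R (Vec.map ρ xs) ≡ true
    Sat η ρ (svar m xs)  = All.lookup η m (Vec.map ρ xs) ≡ true
    Sat η ρ (eq x y)     = ρ x ≡ ρ y
    Sat η ρ (neg φ)      = ¬ Sat η ρ φ
    Sat η ρ (and φ ψ)    = Sat η ρ φ × Sat η ρ ψ
    Sat η ρ (or φ ψ)     = Sat η ρ φ ⊎ Sat η ρ ψ
    Sat η ρ (foQ ∃q φ)   = Σ Dom (λ a → Sat η (a ▸ ρ) φ)
    Sat η ρ (foQ ∀q φ)   = (a : Dom) → Sat η (a ▸ ρ) φ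
    Sat η ρ (soQ ∃q k φ) = Σ (Rel k) (λ r → Sat (r ∷ η) ρ φ)
    Sat η ρ (soQ ∀q k φ) = (r : Rel k) → Sat (r ∷ η) ρ φ

    Models : Sentence → Set
    Models φ = Sat [] (λ ()) φ

  LogEquiv : Sentence → Sentence → Set
  LogEquiv φ ψ = (M : Structure) → (Models M φ → Models M ψ) × (Models M ψ → Models M φ)

  data QF (Γ : SOCtx) (n : ℕ) : Set where
    rel  : (R : Fin (length σ)) → Vec (Fin n) (lookup σ R) → QF Γ n
    svar : ∀ {q k} → (q , k) ∈ Γ → Vec (Fin n) k → QF Γ n
    eq   : Fin n → Fin n → QF Γ n
    neg  : QF Γ n → QF Γ n
    and  : QF Γ n → QF Γ n → QF Γ n
    or   : QF Γ n → QF Γ n → QF Γ n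

  embed : ∀ {Γ n} → QF Γ n → Fm Γ n
  embed (rel R xs)  = rel R xs
  embed (svar m xs) = svar m xs
  embed (eq x y)    = eq x y
  embed (neg φ)     = neg (embed φ)
  embed (and φ ψ)   = and (embed φ) (embed ψ)
  embed (or φ ψ)    = or (embed φ) (embed ψ)

  -- FO prefix as a vector listed INNERMOST first: variable x : Fin n is
  -- bound by the quantifier  Vec.lookup qs x.
  bindFO : ∀ {Γ n} → Vec Qu n → Fm Γ n → Fm Γ 0
  bindFO Vec.[]       φ = φ
  bindFO (q Vec.∷ qs) φ = bindFO qs (foQ q φ)

  record Normalized : Set where
    field
      soP    : SOPrefix
      nFO    : ℕ
      foP    : Vec Qu nFO
      matrix : QF (extend [] soP) nFO

  toFm : Normalized → Sentence
  toFm N = bindSO soP (bindFO foP (embed matrix))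
    where open Normalized N

  data _≈DD_ {Γ n} : QF Γ n → QF Γ n → Set where
    refl′   : ∀ {a} → a ≈DD a
    sym′    : ∀ {a b} → a ≈DD b → b ≈DD a
    trans′  : ∀ {a b c} → a ≈DD b → b ≈DD c → a ≈DD c
    cong-neg : ∀ {a a′} → a ≈DD a′ → neg a ≈DD neg a′
    cong-and : ∀ {a a′ b b′} → a ≈DD a′ → b ≈DD b′ → and a b ≈DD and a′ b′
    cong-or  : ∀ {a a′ b b′} → a ≈DD a′ → b ≈DD b′ → or a b ≈DD or a′ b′
    deMorgan-and : ∀ {a b} → neg (and a b) ≈DD or (neg a) (neg b)
    deMorgan-or  : ∀ {a b} → neg (or a b) ≈DD and (neg a) (neg b)
    double-neg   : ∀ {a} → neg (neg a) ≈DD a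
    distrib-or-andˡ  : ∀ {a b c} → or a (and b c) ≈DD and (or a b) (or a c)
    distrib-or-andʳ  : ∀ {a b c} → or (and b c) a ≈DD and (or b a) (or c a)
    distrib-and-orˡ  : ∀ {a b c} → and a (or b c) ≈DD or (and a b) (and a c)
    distrib-and-orʳ  : ∀ {a b c} → and (or b c) a ≈DD or (and b a) (and c a)

  data IsAtom {Γ n} : QF Γ n → Set where
    atom-rel  : ∀ R xs → IsAtom (rel R xs)
    atom-svar : ∀ {q k} (m : (q , k) ∈ Γ) xs → IsAtom (svar m xs)
    atom-eq   : ∀ x y → IsAtom (eq x y)

  data IsLit {Γ n} : QF Γ n → Set where
    pos : ∀ {a} → IsAtom a → IsLit a
    ngt : ∀ {a} → IsAtom a → IsLit (neg a)

  data IsDClause {Γ n} : QF Γ n → Set where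
    lit : ∀ {a} → IsLit a → IsDClause a
    or  : ∀ {a b} → IsDClause a → IsDClause b → IsDClause (or a b)

  data IsCClause {Γ n} : QF Γ n → Set where
    lit : ∀ {a} → IsLit a → IsCClause a
    and : ∀ {a b} → IsCClause a → IsCClause b → IsCClause (and a b)

  data ConjOf {Γ n} (P : QF Γ n → Set) : QF Γ n → Set where
    one  : ∀ {a} → P a → ConjOf P a
    both : ∀ {a b} → ConjOf P a → ConjOf P b → ConjOf P (and a b)

  data DisjOf {Γ n} (P : QF Γ n → Set) : QF Γ n → Set where
    one  : ∀ {a} → P a → DisjOf P a
    both : ∀ {a b} → DisjOf P a → DisjOf P b → DisjOf P (or a b)

  data HasDisjunct {Γ n} (P : QF Γ n → Set) : QF Γ n → Set where
    here  : ∀ {a} → P a → HasDisjunct P a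
    left  : ∀ {a b} → HasDisjunct P a → HasDisjunct P (or a b)
    right : ∀ {a b} → HasDisjunct P b → HasDisjunct P (or a b)

  data HasConjunct {Γ n} (P : QF Γ n → Set) : QF Γ n → Set where
    here  : ∀ {a} → P a → HasConjunct P a
    left  : ∀ {a b} → HasConjunct P a → HasConjunct P (and a b)
    right : ∀ {a b} → HasConjunct P b → HasConjunct P (and a b)

  Occurs : ∀ {Γ n} → Fin n → QF Γ n → Set
  Occurs x (rel R xs)  = x ∈ᵥ xs
  Occurs x (svar m xs) = x ∈ᵥ xs
  Occurs x (eq y z)    = x ≡ y ⊎ x ≡ z
  Occurs x (neg φ)     = Occurs x φ
  Occurs x (and φ ψ)   = Occurs x φ ⊎ Occurs x ψ
  Occurs x (or φ ψ)    = Occurs x φ ⊎ Occurs x ψ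

  data ExGuard {Γ n} (x : Fin n) : QF Γ n → Set where
    guard : ∀ {k} (m : (∃q , k) ∈ Γ) (xs : Vec (Fin n) k) → x ∈ᵥ xs →
            ExGuard x (neg (svar m xs))

  data AllGuard {Γ n} (x : Fin n) : QF Γ n → Set where
    guard : ∀ {k} (m : (∀q , k) ∈ Γ) (xs : Vec (Fin n) k) → x ∈ᵥ xs →
            AllGuard x (svar m xs)

  GuardedClause : ∀ {Γ n} → Vec Qu n → QF Γ n → Set
  GuardedClause foP c =
    IsDClause c ×
    ((x : Fin _) → Vec.lookup foP x ≡ ∀q → Occurs x c → HasDisjunct (ExGuard x) c)

  RestrictedClause : ∀ {Γ n} → Vec Qu n → QF Γ n → Set
  RestrictedClause foP c =
    IsCClause c ×
    ((x : Fin _) → Vec.lookup foP x ≡ ∃q → Occurs x c → HasConjunct (AllGuard x) c)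

  ExGuardedNF : Normalized → Set
  ExGuardedNF N =
    Σ (QF (extend [] soP) nFO) λ ψ → (matrix ≈DD ψ) × ConjOf (GuardedClause foP) ψ
    where open Normalized N

  AllRestrictedNF : Normalized → Set
  AllRestrictedNF N =
    Σ (QF (extend [] soP) nFO) λ ψ → (matrix ≈DD ψ) × DisjOf (RestrictedClause foP) ψ
    where open Normalized N

  data ExGuarded : Sentence → Set where
    base : (N : Normalized) → ExGuardedNF N → ExGuarded (toFm N)
    conj : (P : SOPrefix) (φ ψ : Fm (extend [] P) 0) →
           ExGuarded (bindSO P φ) → ExGuarded (bindSO P ψ) → ExGuarded (bindSO P (and φ ψ))
    disj : (P : SOPrefix) (φ ψ : Fm (extend [] P) 0) →
           ExGuarded (bindSO P φ) → ExGuarded (bindSO P ψ) → ExGuarded (bindSO P (or φ ψ))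

  data AllRestricted : Sentence → Set where
    base : (N : Normalized) → AllRestrictedNF N → AllRestricted (toFm N)
    conj : (P : SOPrefix) (φ ψ : Fm (extend [] P) 0) →
           AllRestricted (bindSO P φ) → AllRestricted (bindSO P ψ) → AllRestricted (bindSO P (and φ ψ))
    disj : (P : SOPrefix) (φ ψ : Fm (extend [] P) 0) →
           AllRestricted (bindSO P φ) → AllRestricted (bindSO P ψ) → AllRestricted (bindSO P (or φ ψ))

-- Pushing a negation through Q₁S₁ ⋯ QₘSₘ.Ψ complements every quantifier, SO and FO
-- alike, and turns the matrix into its De Morgan dual.  The dual of a CNF is a DNF
-- whose clauses are the duals of the original ones, and the guard ¬S(x̄) of a
-- universally quantified x, with S existential, becomes the conjunct S(x̄), where now
-- S is universal and x existential.  So the dual of an ∃-guarded sentence is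
-- ∀-restricted and vice versa, while internal conjunctions and disjunctions are
-- swapped.  Over finite structures satisfaction is decidable (relations on a finite
-- domain can be searched exhaustively), so the dual is equivalent to the negation
-- and double negations can be dropped.
module Submission where

open import Data.Bool using (Bool; true; false)
import Data.Bool as Bool
open import Data.Fin using (Fin; zero; suc)
import Data.Fin as Fin
open import Data.Fin.Properties using (¬∀⟶∃¬; any?; all?)
open import Data.List using ([]; _∷_)
open import Data.List.Membership.Propositional using (_∈_)
open import Data.List.Relation.Unary.All as All using ([]; _∷_)
open import Data.List.Relation.Unary.Any using (here; there)
open import Data.Nat using (ℕ)
import Data.Nat as ℕ
open import Data.Product using (Σ; ∃; _×_; _,_; proj₁; proj₂)
open import Data.Product.Function.NonDependent.Propositional using (_×-⇔_)
open import Data.Sum using (_⊎_; inj₁; inj₂)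
open import Data.Sum.Function.Propositional using (_⊎-⇔_)
open import Data.Vec using (Vec; []; _∷_; lookup)
import Data.Vec as Vec
open import Data.Vec.Properties using (lookup-map)
import Data.Vec.Functional as Vector
open import Data.Vec.Functional.Relation.Binary.Pointwise using (Pointwise)
open import Function.Bundles using (_⇔_; mk⇔; Equivalence)
open import Function.Properties.Equivalence using (⇔-isEquivalence)
open import Function.Related.TypeIsomorphisms using (¬-cong-⇔)
open import Relation.Binary.Structures using (module IsEquivalence)
open import Relation.Binary.Definitions using (Reflexive; Symmetric; _Respects_)
open import Relation.Binary.PropositionalEquality
  using (_≡_; _≗_; refl; sym; trans; cong; cong₂; subst)
open import Relation.Nullary using (¬_; Dec; yes; no)
open import Relation.Nullary.Negation using (¬∃⟶∀¬; ∀¬⟶¬∃; ∃¬⟶¬∀; ∀⟶¬∃¬)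
open import Relation.Nullary.Decidable using (map′; _×-dec_; _⊎-dec_; ¬?; decidable-stable)
open import Relation.Unary using (Decidable)

open import Defs

open module ⇔ {ℓ} = IsEquivalence (⇔-isEquivalence {ℓ})
  using () renaming (refl to ⇔-refl; sym to ⇔-sym; trans to ⇔-trans)

private variable
  Γ Δ P P′ : SOCtx
  n k : ℕ
  q : Qu

flipQ-injective : ∀ {q q′} → flipQ q ≡ flipQ q′ → q ≡ q′
flipQ-injective {∃q} {∃q} _ = refl
flipQ-injective {∀q} {∀q} _ = refl

lookup-map-flipQ : ∀ (qs : Vec Qu n) x →
                   lookup (Vec.map flipQ qs) x ≡ flipQ q → lookup qs x ≡ q
lookup-map-flipQ qs x e = flipQ-injective (trans (sym (lookup-map x flipQ qs)) e)

data Flipped : SOCtx → SOCtx → Set where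
  []   : Flipped [] []
  ∃↦∀ : Flipped Γ Δ → Flipped ((∃q , k) ∷ Γ) ((∀q , k) ∷ Δ)
  ∀↦∃ : Flipped Γ Δ → Flipped ((∀q , k) ∷ Γ) ((∃q , k) ∷ Δ)

Flipped-sym : Flipped Γ Δ → Flipped Δ Γ
Flipped-sym []      = []
Flipped-sym (∃↦∀ R) = ∀↦∃ (Flipped-sym R)
Flipped-sym (∀↦∃ R) = ∃↦∀ (Flipped-sym R)

Flipped-flipPrefix : ∀ P → Flipped P (flipPrefix P)
Flipped-flipPrefix []            = []
Flipped-flipPrefix ((∃q , k) ∷ P) = ∃↦∀ (Flipped-flipPrefix P)
Flipped-flipPrefix ((∀q , k) ∷ P) = ∀↦∃ (Flipped-flipPrefix P)

Flipped-extend : Flipped Γ Δ → Flipped P P′ → Flipped (extend Γ P) (extend Δ P′)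
Flipped-extend R []      = R
Flipped-extend R (∃↦∀ F) = Flipped-extend (∃↦∀ R) F
Flipped-extend R (∀↦∃ F) = Flipped-extend (∀↦∃ R) F

flip-∈ : Flipped Γ Δ → (q , k) ∈ Γ → (flipQ q , k) ∈ Δ
flip-∈ (∃↦∀ R) (here refl) = here refl
flip-∈ (∀↦∃ R) (here refl) = here refl
flip-∈ (∃↦∀ R) (there m)   = there (flip-∈ R m)
flip-∈ (∀↦∃ R) (there m)   = there (flip-∈ R m)

module _ {σ : Sig} where

  -- rename φ means φ and dual φ means ¬φ, read in the flipped context.  A bound SO
  -- variable keeps its quantifier under rename, but Flipped only extends contexts by
  -- complemented tags, so rename treats an SO quantifier as the negation of its dual.
  mutual
    rename : Flipped Γ Δ → Fm σ Γ n → Fm σ Δ n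
    rename R (rel r xs)  = rel r xs
    rename R (svar m xs) = svar (flip-∈ R m) xs
    rename R (eq x y)    = eq x y
    rename R (neg φ)     = neg (rename R φ)
    rename R (and φ ψ)   = and (rename R φ) (rename R ψ)
    rename R (or φ ψ)    = or (rename R φ) (rename R ψ)
    rename R (foQ q φ)   = foQ q (rename R φ)
    rename R (soQ q k φ) = neg (dual R (soQ q k φ))

    dual : Flipped Γ Δ → Fm σ Γ n → Fm σ Δ n
    dual R (rel r xs)    = neg (rel r xs)
    dual R (svar m xs)   = neg (svar (flip-∈ R m) xs)
    dual R (eq x y)      = neg (eq x y)
    dual R (neg φ)       = rename R φ
    dual R (and φ ψ)     = or (dual R φ) (dual R ψ)
    dual R (or φ ψ)      = and (dual R φ) (dual R ψ)
    dual R (foQ q φ)     = foQ (flipQ q) (dual R φ)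
    dual R (soQ ∃q k φ)  = soQ ∀q k (dual (∃↦∀ R) φ)
    dual R (soQ ∀q k φ)  = soQ ∃q k (dual (∀↦∃ R) φ)

  renameQF : Flipped Γ Δ → QF σ Γ n → QF σ Δ n
  renameQF R (rel r xs)  = rel r xs
  renameQF R (svar m xs) = svar (flip-∈ R m) xs
  renameQF R (eq x y)    = eq x y
  renameQF R (neg a)     = neg (renameQF R a)
  renameQF R (and a b)   = and (renameQF R a) (renameQF R b)
  renameQF R (or a b)    = or (renameQF R a) (renameQF R b)

  dualQF : Flipped Γ Δ → QF σ Γ n → QF σ Δ n
  dualQF R (rel r xs)  = neg (rel r xs)
  dualQF R (svar m xs) = neg (svar (flip-∈ R m) xs)
  dualQF R (eq x y)    = neg (eq x y)
  dualQF R (neg a)     = renameQF R a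
  dualQF R (and a b)   = or (dualQF R a) (dualQF R b)
  dualQF R (or a b)    = and (dualQF R a) (dualQF R b)

  rename-embed : (R : Flipped Γ Δ) (a : QF σ Γ n) →
                 rename R (embed σ a) ≡ embed σ (renameQF R a)
  rename-embed R (rel r xs)  = refl
  rename-embed R (svar m xs) = refl
  rename-embed R (eq x y)    = refl
  rename-embed R (neg a)     = cong neg (rename-embed R a)
  rename-embed R (and a b)   = cong₂ and (rename-embed R a) (rename-embed R b)
  rename-embed R (or a b)    = cong₂ or (rename-embed R a) (rename-embed R b)

  dual-embed : (R : Flipped Γ Δ) (a : QF σ Γ n) →
               dual R (embed σ a) ≡ embed σ (dualQF R a)
  dual-embed R (rel r xs)  = refl
  dual-embed R (svar m xs) = refl
  dual-embed R (eq x y)    = refl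
  dual-embed R (neg a)     = rename-embed R a
  dual-embed R (and a b)   = cong₂ or (dual-embed R a) (dual-embed R b)
  dual-embed R (or a b)    = cong₂ and (dual-embed R a) (dual-embed R b)

  dual-bindFO : (R : Flipped Γ Δ) (qs : Vec Qu n) (φ : Fm σ Γ n) →
                dual R (bindFO σ qs φ) ≡ bindFO σ (Vec.map flipQ qs) (dual R φ)
  dual-bindFO R []       φ = refl
  dual-bindFO R (q ∷ qs) φ = dual-bindFO R qs (foQ q φ)

  dual-bindSO : (R : Flipped Γ Δ) (F : Flipped P P′) (φ : Fm σ (extend Γ P) n) →
                dual R (bindSO σ P φ) ≡ bindSO σ P′ (dual (Flipped-extend R F) φ)
  dual-bindSO R []      φ = refl
  dual-bindSO R (∃↦∀ F) φ = cong (soQ ∀q _) (dual-bindSO (∃↦∀ R) F φ)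
  dual-bindSO R (∀↦∃ F) φ = cong (soQ ∃q _) (dual-bindSO (∀↦∃ R) F φ)

  dualNF : Normalized σ → Normalized σ
  dualNF N = record
    { soP    = flipPrefix soP
    ; nFO    = nFO
    ; foP    = Vec.map flipQ foP
    ; matrix = dualQF (Flipped-extend [] (Flipped-flipPrefix soP)) matrix
    }
    where open Normalized N

  dual-toFm : (N : Normalized σ) → dual [] (toFm σ N) ≡ toFm σ (dualNF N)
  dual-toFm N = trans (dual-bindSO [] (Flipped-flipPrefix soP) _)
    (cong (bindSO σ (flipPrefix soP))
      (trans (dual-bindFO R foP _) (cong (bindFO σ (Vec.map flipQ foP)) (dual-embed R matrix))))
    where
    open Normalized N
    R = Flipped-extend [] (Flipped-flipPrefix soP)

  renameQF-cong : (R : Flipped Γ Δ) {a b : QF σ Γ n} →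
                  _≈DD_ σ a b → _≈DD_ σ (renameQF R a) (renameQF R b)
  renameQF-cong R refl′            = refl′
  renameQF-cong R (sym′ e)         = sym′ (renameQF-cong R e)
  renameQF-cong R (trans′ e f)     = trans′ (renameQF-cong R e) (renameQF-cong R f)
  renameQF-cong R (cong-neg e)     = cong-neg (renameQF-cong R e)
  renameQF-cong R (cong-and e f)   = cong-and (renameQF-cong R e) (renameQF-cong R f)
  renameQF-cong R (cong-or e f)    = cong-or (renameQF-cong R e) (renameQF-cong R f)
  renameQF-cong R deMorgan-and     = deMorgan-and
  renameQF-cong R deMorgan-or      = deMorgan-or
  renameQF-cong R double-neg       = double-neg
  renameQF-cong R distrib-or-andˡ  = distrib-or-andˡ
  renameQF-cong R distrib-or-andʳ  = distrib-or-andʳ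
  renameQF-cong R distrib-and-orˡ  = distrib-and-orˡ
  renameQF-cong R distrib-and-orʳ  = distrib-and-orʳ

  dualQF≈neg-renameQF : (R : Flipped Γ Δ) (a : QF σ Γ n) →
                        _≈DD_ σ (dualQF R a) (neg (renameQF R a))
  dualQF≈neg-renameQF R (rel r xs)  = refl′
  dualQF≈neg-renameQF R (svar m xs) = refl′
  dualQF≈neg-renameQF R (eq x y)    = refl′
  dualQF≈neg-renameQF R (neg a)     = sym′ double-neg
  dualQF≈neg-renameQF R (and a b)   = trans′
    (cong-or (dualQF≈neg-renameQF R a) (dualQF≈neg-renameQF R b)) (sym′ deMorgan-and)
  dualQF≈neg-renameQF R (or a b)    = trans′
    (cong-and (dualQF≈neg-renameQF R a) (dualQF≈neg-renameQF R b)) (sym′ deMorgan-or)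

  dualQF-cong : (R : Flipped Γ Δ) {a b : QF σ Γ n} →
                _≈DD_ σ a b → _≈DD_ σ (dualQF R a) (dualQF R b)
  dualQF-cong R {a} {b} e =
    trans′ (dualQF≈neg-renameQF R a)
      (trans′ (cong-neg (renameQF-cong R e)) (sym′ (dualQF≈neg-renameQF R b)))

  renameQF-IsAtom : (R : Flipped Γ Δ) {a : QF σ Γ n} →
                    IsAtom σ a → IsAtom σ (renameQF R a)
  renameQF-IsAtom R (atom-rel r xs)  = atom-rel r xs
  renameQF-IsAtom R (atom-svar m xs) = atom-svar (flip-∈ R m) xs
  renameQF-IsAtom R (atom-eq x y)    = atom-eq x y

  dualQF-IsLit : (R : Flipped Γ Δ) {a : QF σ Γ n} → IsLit σ a → IsLit σ (dualQF R a)
  dualQF-IsLit R (pos (atom-rel r xs))  = ngt (atom-rel r xs)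
  dualQF-IsLit R (pos (atom-svar m xs)) = ngt (atom-svar (flip-∈ R m) xs)
  dualQF-IsLit R (pos (atom-eq x y))    = ngt (atom-eq x y)
  dualQF-IsLit R (ngt a)                = pos (renameQF-IsAtom R a)

  dualQF-IsDClause : (R : Flipped Γ Δ) {a : QF σ Γ n} →
                     IsDClause σ a → IsCClause σ (dualQF R a)
  dualQF-IsDClause R (lit l)  = lit (dualQF-IsLit R l)
  dualQF-IsDClause R (or a b) = and (dualQF-IsDClause R a) (dualQF-IsDClause R b)

  dualQF-IsCClause : (R : Flipped Γ Δ) {a : QF σ Γ n} →
                     IsCClause σ a → IsDClause σ (dualQF R a)
  dualQF-IsCClause R (lit l)   = lit (dualQF-IsLit R l)
  dualQF-IsCClause R (and a b) = or (dualQF-IsCClause R a) (dualQF-IsCClause R b)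

  Occurs-renameQF : (R : Flipped Γ Δ) (x : Fin n) (a : QF σ Γ n) →
                    Occurs σ x (renameQF R a) → Occurs σ x a
  Occurs-renameQF R x (rel r xs)  o        = o
  Occurs-renameQF R x (svar m xs) o        = o
  Occurs-renameQF R x (eq y z)    o        = o
  Occurs-renameQF R x (neg a)     o        = Occurs-renameQF R x a o
  Occurs-renameQF R x (and a b)   (inj₁ o) = inj₁ (Occurs-renameQF R x a o)
  Occurs-renameQF R x (and a b)   (inj₂ o) = inj₂ (Occurs-renameQF R x b o)
  Occurs-renameQF R x (or a b)    (inj₁ o) = inj₁ (Occurs-renameQF R x a o)
  Occurs-renameQF R x (or a b)    (inj₂ o) = inj₂ (Occurs-renameQF R x b o)

  Occurs-dualQF : (R : Flipped Γ Δ) (x : Fin n) (a : QF σ Γ n) →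
                  Occurs σ x (dualQF R a) → Occurs σ x a
  Occurs-dualQF R x (rel r xs)  o        = o
  Occurs-dualQF R x (svar m xs) o        = o
  Occurs-dualQF R x (eq y z)    o        = o
  Occurs-dualQF R x (neg a)     o        = Occurs-renameQF R x a o
  Occurs-dualQF R x (and a b)   (inj₁ o) = inj₁ (Occurs-dualQF R x a o)
  Occurs-dualQF R x (and a b)   (inj₂ o) = inj₂ (Occurs-dualQF R x b o)
  Occurs-dualQF R x (or a b)    (inj₁ o) = inj₁ (Occurs-dualQF R x a o)
  Occurs-dualQF R x (or a b)    (inj₂ o) = inj₂ (Occurs-dualQF R x b o)

  dualQF-ExGuard : (R : Flipped Γ Δ) (x : Fin n) {a : QF σ Γ n} →
    HasDisjunct σ (ExGuard σ x) a → HasConjunct σ (AllGuard σ x) (dualQF R a)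
  dualQF-ExGuard R x (here (guard m xs x∈xs)) = here (guard (flip-∈ R m) xs x∈xs)
  dualQF-ExGuard R x (left h)                 = left (dualQF-ExGuard R x h)
  dualQF-ExGuard R x (right h)                = right (dualQF-ExGuard R x h)

  dualQF-AllGuard : (R : Flipped Γ Δ) (x : Fin n) {a : QF σ Γ n} →
    HasConjunct σ (AllGuard σ x) a → HasDisjunct σ (ExGuard σ x) (dualQF R a)
  dualQF-AllGuard R x (here (guard m xs x∈xs)) = here (guard (flip-∈ R m) xs x∈xs)
  dualQF-AllGuard R x (left h)                 = left (dualQF-AllGuard R x h)
  dualQF-AllGuard R x (right h)                = right (dualQF-AllGuard R x h)

  dualQF-GuardedClause : (R : Flipped Γ Δ) (qs : Vec Qu n) {a : QF σ Γ n} →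
    GuardedClause σ qs a → RestrictedClause σ (Vec.map flipQ qs) (dualQF R a)
  dualQF-GuardedClause R qs {a} (clause , guarded) =
    dualQF-IsDClause R clause ,
    λ x x∃ o → dualQF-ExGuard R x
                 (guarded x (lookup-map-flipQ qs x x∃) (Occurs-dualQF R x a o))

  dualQF-RestrictedClause : (R : Flipped Γ Δ) (qs : Vec Qu n) {a : QF σ Γ n} →
    RestrictedClause σ qs a → GuardedClause σ (Vec.map flipQ qs) (dualQF R a)
  dualQF-RestrictedClause R qs {a} (clause , restricted) =
    dualQF-IsCClause R clause ,
    λ x x∀ o → dualQF-AllGuard R x
                 (restricted x (lookup-map-flipQ qs x x∀) (Occurs-dualQF R x a o))

  dualQF-CNF : (R : Flipped Γ Δ) (qs : Vec Qu n) {a : QF σ Γ n} →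
    ConjOf σ (GuardedClause σ qs) a →
    DisjOf σ (RestrictedClause σ (Vec.map flipQ qs)) (dualQF R a)
  dualQF-CNF R qs (one c)    = one (dualQF-GuardedClause R qs c)
  dualQF-CNF R qs (both a b) = both (dualQF-CNF R qs a) (dualQF-CNF R qs b)

  dualQF-DNF : (R : Flipped Γ Δ) (qs : Vec Qu n) {a : QF σ Γ n} →
    DisjOf σ (RestrictedClause σ qs) a →
    ConjOf σ (GuardedClause σ (Vec.map flipQ qs)) (dualQF R a)
  dualQF-DNF R qs (one c)    = one (dualQF-RestrictedClause R qs c)
  dualQF-DNF R qs (both a b) = both (dualQF-DNF R qs a) (dualQF-DNF R qs b)

  dualNF-ExGuardedNF : (N : Normalized σ) → ExGuardedNF σ N → AllRestrictedNF σ (dualNF N)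
  dualNF-ExGuardedNF N (ψ , matrix≈ψ , cnf) =
    dualQF R ψ , dualQF-cong R matrix≈ψ , dualQF-CNF R (Normalized.foP N) cnf
    where R = Flipped-extend [] (Flipped-flipPrefix (Normalized.soP N))

  dualNF-AllRestrictedNF : (N : Normalized σ) →
                           AllRestrictedNF σ N → ExGuardedNF σ (dualNF N)
  dualNF-AllRestrictedNF N (ψ , matrix≈ψ , dnf) =
    dualQF R ψ , dualQF-cong R matrix≈ψ , dualQF-DNF R (Normalized.foP N) dnf
    where R = Flipped-extend [] (Flipped-flipPrefix (Normalized.soP N))

  dualᴾ : Flipped P P′ → Fm σ (extend [] P) n → Fm σ (extend [] P′) n
  dualᴾ F = dual (Flipped-extend [] F)

  module _ (C : Sentence σ → Set) (F : Flipped P P′) (φ : Fm σ (extend [] P) 0) where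

    push-dual : C (dual [] (bindSO σ P φ)) → C (bindSO σ P′ (dualᴾ F φ))
    push-dual = subst C (dual-bindSO [] F φ)

    pull-dual : C (bindSO σ P′ (dualᴾ F φ)) → C (dual [] (bindSO σ P φ))
    pull-dual = subst C (sym (dual-bindSO [] F φ))

  ExGuarded-dual : {φ : Sentence σ} → ExGuarded σ φ → AllRestricted σ (dual [] φ)
  ExGuarded-dual (base N g) =
    subst (AllRestricted σ) (sym (dual-toFm N)) (base (dualNF N) (dualNF-ExGuardedNF N g))
  ExGuarded-dual (conj P φ ψ g h) = pull-dual (AllRestricted σ) F (and φ ψ)
    (disj _ _ _ (push-dual (AllRestricted σ) F φ (ExGuarded-dual g))
                (push-dual (AllRestricted σ) F ψ (ExGuarded-dual h)))
    where F = Flipped-flipPrefix P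
  ExGuarded-dual (disj P φ ψ g h) = pull-dual (AllRestricted σ) F (or φ ψ)
    (conj _ _ _ (push-dual (AllRestricted σ) F φ (ExGuarded-dual g))
                (push-dual (AllRestricted σ) F ψ (ExGuarded-dual h)))
    where F = Flipped-flipPrefix P

  AllRestricted-dual : {φ : Sentence σ} → AllRestricted σ φ → ExGuarded σ (dual [] φ)
  AllRestricted-dual (base N r) =
    subst (ExGuarded σ) (sym (dual-toFm N)) (base (dualNF N) (dualNF-AllRestrictedNF N r))
  AllRestricted-dual (conj P φ ψ r s) = pull-dual (ExGuarded σ) F (and φ ψ)
    (disj _ _ _ (push-dual (ExGuarded σ) F φ (AllRestricted-dual r))
                (push-dual (ExGuarded σ) F ψ (AllRestricted-dual s)))
    where F = Flipped-flipPrefix P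
  AllRestricted-dual (disj P φ ψ r s) = pull-dual (ExGuarded σ) F (or φ ψ)
    (conj _ _ _ (push-dual (ExGuarded σ) F φ (AllRestricted-dual r))
                (push-dual (ExGuarded σ) F ψ (AllRestricted-dual s)))
    where F = Flipped-flipPrefix P

¬¬⇔ : {A : Set} → Dec A → (¬ ¬ A) ⇔ A
¬¬⇔ A? = mk⇔ (decidable-stable A?) (λ a ¬a → ¬a a)

module _ {A B : Set} where

  ¬×⇔¬⊎¬ : Dec A → (¬ (A × B)) ⇔ (¬ A ⊎ ¬ B)
  ¬×⇔¬⊎¬ (yes a) = mk⇔ (λ ¬a×b → inj₂ (λ b → ¬a×b (a , b)))
    (λ { (inj₁ ¬a) (a , _) → ¬a a ; (inj₂ ¬b) (_ , b) → ¬b b })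
  ¬×⇔¬⊎¬ (no ¬a) = mk⇔ (λ _ → inj₁ ¬a) (λ _ (a , _) → ¬a a)

  ¬⊎⇔¬×¬ : (¬ (A ⊎ B)) ⇔ (¬ A × ¬ B)
  ¬⊎⇔¬×¬ = mk⇔ (λ ¬a⊎b → (λ a → ¬a⊎b (inj₁ a)) , (λ b → ¬a⊎b (inj₂ b)))
    (λ { (¬a , ¬b) (inj₁ a) → ¬a a ; (¬a , ¬b) (inj₂ b) → ¬b b })

module _ {A : Set} {P Q : A → Set} where

  ∀-⇔ : (∀ x → P x ⇔ Q x) → (∀ x → P x) ⇔ (∀ x → Q x)
  ∀-⇔ P⇔Q = mk⇔ (λ p x → Equivalence.to (P⇔Q x) (p x))
                (λ q x → Equivalence.from (P⇔Q x) (q x))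

  ∃-⇔ : (∀ x → P x ⇔ Q x) → ∃ P ⇔ ∃ Q
  ∃-⇔ P⇔Q = mk⇔ (λ (x , p) → x , Equivalence.to (P⇔Q x) p)
                (λ (x , q) → x , Equivalence.from (P⇔Q x) q)

module _ {A : Set} {P : A → Set} where

  ¬∃⇔∀¬ : (¬ ∃ P) ⇔ (∀ x → ¬ P x)
  ¬∃⇔∀¬ = mk⇔ ¬∃⟶∀¬ ∀¬⟶¬∃

  ¬∀⇔∃¬ : (¬ (∀ x → P x) → ∃ λ x → ¬ P x) → (¬ (∀ x → P x)) ⇔ (∃ λ x → ¬ P x)
  ¬∀⇔∃¬ ¬∀⟶∃¬′ = mk⇔ ¬∀⟶∃¬′ ∃¬⟶¬∀

Searchable : (A : Set) → (A → A → Set) → Set₁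
Searchable A _≈_ = ∀ {P : A → Set} → P Respects _≈_ → Decidable P → Dec (∃ P)

module _ {A : Set} {_≈_ : A → A → Set}
         (search : Searchable A _≈_) (≈-sym : Symmetric _≈_)
         {P : A → Set} (resp : P Respects _≈_) (P? : Decidable P) where

  private
    ∃¬? : Dec (∃ λ x → ¬ P x)
    ∃¬? = search (λ x≈y ¬px py → ¬px (resp (≈-sym x≈y) py)) (λ x → ¬? (P? x))

    ¬∃¬⟶∀ : ¬ (∃ λ x → ¬ P x) → ∀ x → P x
    ¬∃¬⟶∀ ¬∃¬ x = decidable-stable (P? x) (λ ¬px → ¬∃¬ (x , ¬px))

  search-all? : Dec (∀ x → P x)
  search-all? = map′ ¬∃¬⟶∀ ∀⟶¬∃¬ (¬? ∃¬?)

  search-¬∀⟶∃¬ : ¬ (∀ x → P x) → ∃ λ x → ¬ P x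
  search-¬∀⟶∃¬ ¬∀ = decidable-stable ∃¬? (λ ¬∃¬ → ¬∀ (¬∃¬⟶∀ ¬∃¬))

searchable-Bool : Searchable Bool _≡_
searchable-Bool _ P? = map′ from-⊎ to-⊎ (P? true ⊎-dec P? false)
  where
  from-⊎ : _ ⊎ _ → ∃ _
  from-⊎ (inj₁ p) = true , p
  from-⊎ (inj₂ p) = false , p
  to-⊎ : ∃ _ → _ ⊎ _
  to-⊎ (true , p)  = inj₁ p
  to-⊎ (false , p) = inj₂ p

searchable-Vector : ∀ {C : Set} {_≈_ : C → C → Set} → Reflexive _≈_ → Searchable C _≈_ →
                    ∀ m → Searchable (Vector.Vector C m) (Pointwise _≈_)
searchable-Vector ≈-refl search ℕ.zero resp P? =
  map′ (λ p → Vector.[] , p) (λ (f , p) → resp (λ ()) p) (P? Vector.[])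
searchable-Vector {C} {_≈_} ≈-refl search (ℕ.suc m) {P} resp P? =
  map′ (λ (c , g , p) → c Vector.∷ g , p)
       (λ (f , p) → Vector.head f , Vector.tail f ,
                     resp (λ { zero → ≈-refl ; (suc i) → ≈-refl }) p)
       (search resp-head λ c →
          searchable-Vector ≈-refl search m (resp-tail c) (λ g → P? (c Vector.∷ g)))
  where
  resp-head : (λ c → ∃ λ g → P (c Vector.∷ g)) Respects _≈_
  resp-head c≈c′ (g , p) = g , resp (λ { zero → c≈c′ ; (suc i) → ≈-refl }) p
  resp-tail : ∀ c → (λ g → P (c Vector.∷ g)) Respects Pointwise _≈_
  resp-tail c g≈g′ = resp (λ { zero → ≈-refl ; (suc i) → g≈g′ i })

searchable-Rel : ∀ {d} k → Searchable (Vec (Fin d) k → Bool) _≗_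
searchable-Rel ℕ.zero resp P? =
  map′ (λ (b , p) → (λ _ → b) , p) (λ (r , p) → r [] , resp (λ { [] → refl }) p)
       (searchable-Bool (λ { refl p → p }) (λ b → P? (λ _ → b)))
searchable-Rel {d} (ℕ.suc k) resp P? =
  map′ (λ (g , p) → uncurry g , p)
       (λ (r , p) → (λ x v → r (x ∷ v)) , resp (λ { (x ∷ v) → refl }) p)
       (searchable-Vector (λ _ → refl) (searchable-Rel k) d
          (λ g≗g′ → resp (λ { (x ∷ v) → g≗g′ x v })) (λ g → P? (uncurry g)))
  where
  uncurry : (Fin d → Vec (Fin d) k → Bool) → Vec (Fin d) (ℕ.suc k) → Bool
  uncurry g (x ∷ v) = g x v

module _ {σ : Sig} (M : Structure σ) where

  _≐_ : SOEnv σ M Γ → SOEnv σ M Γ → Set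
  _≐_ {Γ} η η′ = ∀ {q k} (m : (q , k) ∈ Γ) → All.lookup η m ≗ All.lookup η′ m

  ≐-∷ : {r r′ : Rel σ M k} {η η′ : SOEnv σ M Γ} → r ≗ r′ → η ≐ η′ →
        _≐_ {(q , k) ∷ Γ} (r ∷ η) (r′ ∷ η′)
  ≐-∷ r≗r′ η≐η′ (here refl) = r≗r′
  ≐-∷ r≗r′ η≐η′ (there m)   = η≐η′ m

  Sat-resp : {η η′ : SOEnv σ M Γ} {ρ : Fin n → Dom σ M} → η ≐ η′ → (φ : Fm σ Γ n) →
             Sat σ M η ρ φ → Sat σ M η′ ρ φ
  Sat-resp η≐η′ (rel r xs)   s        = s
  Sat-resp {ρ = ρ} η≐η′ (svar m xs) s = trans (sym (η≐η′ m (Vec.map ρ xs))) s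
  Sat-resp η≐η′ (eq x y)     s        = s
  Sat-resp η≐η′ (neg φ)      ¬s s′    = ¬s (Sat-resp (λ m v → sym (η≐η′ m v)) φ s′)
  Sat-resp η≐η′ (and φ ψ)    (s , t)  = Sat-resp η≐η′ φ s , Sat-resp η≐η′ ψ t
  Sat-resp η≐η′ (or φ ψ)     (inj₁ s) = inj₁ (Sat-resp η≐η′ φ s)
  Sat-resp η≐η′ (or φ ψ)     (inj₂ t) = inj₂ (Sat-resp η≐η′ ψ t)
  Sat-resp η≐η′ (foQ ∃q φ)   (a , s)  = a , Sat-resp η≐η′ φ s
  Sat-resp η≐η′ (foQ ∀q φ)   s        = λ a → Sat-resp η≐η′ φ (s a)
  Sat-resp η≐η′ (soQ ∃q k φ) (r , s)  = r , Sat-resp (≐-∷ (λ _ → refl) η≐η′) φ s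
  Sat-resp η≐η′ (soQ ∀q k φ) s        = λ r → Sat-resp (≐-∷ (λ _ → refl) η≐η′) φ (s r)

  Sat-head-resp : (η : SOEnv σ M Γ) (ρ : Fin n → Dom σ M) (φ : Fm σ ((q , k) ∷ Γ) n) →
                  (λ r → Sat σ M (r ∷ η) ρ φ) Respects _≗_
  Sat-head-resp η ρ φ r≗r′ = Sat-resp (≐-∷ r≗r′ (λ _ _ → refl)) φ

  sat? : (η : SOEnv σ M Γ) (ρ : Fin n → Dom σ M) (φ : Fm σ Γ n) → Dec (Sat σ M η ρ φ)
  sat? η ρ (rel R xs)   = Structure.interp M R (Vec.map ρ xs) Bool.≟ true
  sat? η ρ (svar m xs)  = All.lookup η m (Vec.map ρ xs) Bool.≟ true
  sat? η ρ (eq x y)     = ρ x Fin.≟ ρ y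
  sat? η ρ (neg φ)      = ¬? (sat? η ρ φ)
  sat? η ρ (and φ ψ)    = sat? η ρ φ ×-dec sat? η ρ ψ
  sat? η ρ (or φ ψ)     = sat? η ρ φ ⊎-dec sat? η ρ ψ
  sat? η ρ (foQ ∃q φ)   = any? (λ a → sat? η (_▸_ σ M a ρ) φ)
  sat? η ρ (foQ ∀q φ)   = all? (λ a → sat? η (_▸_ σ M a ρ) φ)
  sat? η ρ (soQ ∃q k φ) = searchable-Rel k (Sat-head-resp η ρ φ) (λ r → sat? (r ∷ η) ρ φ)
  sat? η ρ (soQ ∀q k φ) =
    search-all? (searchable-Rel k) (λ r≗r′ v → sym (r≗r′ v))
                (Sat-head-resp η ρ φ) (λ r → sat? (r ∷ η) ρ φ)

  flipEnv : Flipped Γ Δ → SOEnv σ M Γ → SOEnv σ M Δ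
  flipEnv []      []      = []
  flipEnv (∃↦∀ R) (r ∷ η) = r ∷ flipEnv R η
  flipEnv (∀↦∃ R) (r ∷ η) = r ∷ flipEnv R η

  lookup-flipEnv : (R : Flipped Γ Δ) (η : SOEnv σ M Γ) (m : (q , k) ∈ Γ) →
                   All.lookup (flipEnv R η) (flip-∈ R m) ≡ All.lookup η m
  lookup-flipEnv (∃↦∀ R) (r ∷ η) (here refl) = refl
  lookup-flipEnv (∀↦∃ R) (r ∷ η) (here refl) = refl
  lookup-flipEnv (∃↦∀ R) (r ∷ η) (there m)   = lookup-flipEnv R η m
  lookup-flipEnv (∀↦∃ R) (r ∷ η) (there m)   = lookup-flipEnv R η m

  mutual
    rename-sound : (R : Flipped Γ Δ) (η : SOEnv σ M Γ) (ρ : Fin n → Dom σ M) (φ : Fm σ Γ n) →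
                   Sat σ M (flipEnv R η) ρ (rename R φ) ⇔ Sat σ M η ρ φ
    rename-sound R η ρ (rel r xs)  = ⇔-refl
    rename-sound R η ρ (svar m xs) rewrite lookup-flipEnv R η m = ⇔-refl
    rename-sound R η ρ (eq x y)    = ⇔-refl
    rename-sound R η ρ (neg φ)     = ¬-cong-⇔ (rename-sound R η ρ φ)
    rename-sound R η ρ (and φ ψ)   = rename-sound R η ρ φ ×-⇔ rename-sound R η ρ ψ
    rename-sound R η ρ (or φ ψ)    = rename-sound R η ρ φ ⊎-⇔ rename-sound R η ρ ψ
    rename-sound R η ρ (foQ ∃q φ)  = ∃-⇔ λ a → rename-sound R η (_▸_ σ M a ρ) φ
    rename-sound R η ρ (foQ ∀q φ)  = ∀-⇔ λ a → rename-sound R η (_▸_ σ M a ρ) φ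
    rename-sound R η ρ (soQ q k φ) =
      ⇔-trans (¬-cong-⇔ (dual-sound R η ρ (soQ q k φ))) (¬¬⇔ (sat? η ρ (soQ q k φ)))

    dual-sound : (R : Flipped Γ Δ) (η : SOEnv σ M Γ) (ρ : Fin n → Dom σ M) (φ : Fm σ Γ n) →
                 Sat σ M (flipEnv R η) ρ (dual R φ) ⇔ (¬ Sat σ M η ρ φ)
    dual-sound R η ρ (rel r xs)   = ⇔-refl
    dual-sound R η ρ (svar m xs)  = ¬-cong-⇔ (rename-sound R η ρ (svar m xs))
    dual-sound R η ρ (eq x y)     = ⇔-refl
    dual-sound R η ρ (neg φ)      = ⇔-trans (rename-sound R η ρ φ) (⇔-sym (¬¬⇔ (sat? η ρ φ)))
    dual-sound R η ρ (and φ ψ)    =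
      ⇔-trans (dual-sound R η ρ φ ⊎-⇔ dual-sound R η ρ ψ) (⇔-sym (¬×⇔¬⊎¬ (sat? η ρ φ)))
    dual-sound R η ρ (or φ ψ)     =
      ⇔-trans (dual-sound R η ρ φ ×-⇔ dual-sound R η ρ ψ) (⇔-sym ¬⊎⇔¬×¬)
    dual-sound R η ρ (foQ ∃q φ)   =
      ⇔-trans (∀-⇔ λ a → dual-sound R η (_▸_ σ M a ρ) φ) (⇔-sym ¬∃⇔∀¬)
    dual-sound R η ρ (foQ ∀q φ)   =
      ⇔-trans (∃-⇔ λ a → dual-sound R η (_▸_ σ M a ρ) φ)
        (⇔-sym (¬∀⇔∃¬ (¬∀⟶∃¬ _ _ λ a → sat? η (_▸_ σ M a ρ) φ)))
    dual-sound R η ρ (soQ ∃q k φ) =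
      ⇔-trans (∀-⇔ λ r → dual-sound (∃↦∀ R) (r ∷ η) ρ φ) (⇔-sym ¬∃⇔∀¬)
    dual-sound R η ρ (soQ ∀q k φ) =
      ⇔-trans (∃-⇔ λ r → dual-sound (∀↦∃ R) (r ∷ η) ρ φ)
        (⇔-sym (¬∀⇔∃¬ (search-¬∀⟶∃¬ (searchable-Rel k) (λ r≗r′ v → sym (r≗r′ v))
                         (Sat-head-resp η ρ φ) (λ r → sat? (r ∷ η) ρ φ))))

  models? : (φ : Sentence σ) → Dec (Models σ M φ)
  models? φ = sat? [] _ φ

  Models-dual : (φ : Sentence σ) → Models σ M (dual [] φ) ⇔ (¬ Models σ M φ)
  Models-dual φ = dual-sound [] [] _ φ

module _ {σ : Sig} {φ ψ : Sentence σ} where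

  LogEquiv⇒⇔ : LogEquiv σ φ ψ → ∀ M → Models σ M φ ⇔ Models σ M ψ
  LogEquiv⇒⇔ φ≡ψ M = mk⇔ (proj₁ (φ≡ψ M)) (proj₂ (φ≡ψ M))

  ⇔⇒LogEquiv : (∀ M → Models σ M φ ⇔ Models σ M ψ) → LogEquiv σ φ ψ
  ⇔⇒LogEquiv φ⇔ψ M = Equivalence.to (φ⇔ψ M) , Equivalence.from (φ⇔ψ M)

module _ {σ : Sig} {φ ψ : Sentence σ} where

  dual-LogEquiv-neg : LogEquiv σ φ ψ → LogEquiv σ (dual [] φ) (neg ψ)
  dual-LogEquiv-neg φ≡ψ = ⇔⇒LogEquiv {ψ = neg ψ} λ M →
    ⇔-trans (Models-dual M φ) (¬-cong-⇔ (LogEquiv⇒⇔ {φ = φ} {ψ = ψ} φ≡ψ M))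

  dual-LogEquiv : LogEquiv σ φ (neg ψ) → LogEquiv σ (dual [] φ) ψ
  dual-LogEquiv φ≡¬ψ = ⇔⇒LogEquiv λ M →
    ⇔-trans (Models-dual M φ)
      (⇔-trans (¬-cong-⇔ (LogEquiv⇒⇔ {φ = φ} {ψ = neg ψ} φ≡¬ψ M)) (¬¬⇔ (models? M ψ)))

lemma3p7 : (σ : Sig) (P : SOPrefix) (Φ* : Fm σ (extend [] P) 0) →
    (Σ (Fm σ (extend [] P) 0) λ Ψ∃ →
        ExGuarded σ (bindSO σ P Ψ∃) × LogEquiv σ (bindSO σ P Ψ∃) (bindSO σ P Φ*))
    ⇔
    (Σ (Fm σ (extend [] (flipPrefix P)) 0) λ Ψ∀ →
        AllRestricted σ (bindSO σ (flipPrefix P) Ψ∀)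
          × LogEquiv σ (bindSO σ (flipPrefix P) Ψ∀) (neg (bindSO σ P Φ*)))
lemma3p7 σ P Φ* = mk⇔
  (λ (Ψ∃ , guarded , Ψ∃≡Φ) → dualᴾ F Ψ∃ ,
     push-dual (λ χ → AllRestricted σ χ × LogEquiv σ χ (neg Φ)) F Ψ∃
       (ExGuarded-dual guarded , dual-LogEquiv-neg Ψ∃≡Φ))
  (λ (Ψ∀ , restricted , Ψ∀≡¬Φ) → dualᴾ (Flipped-sym F) Ψ∀ ,
     push-dual (λ χ → ExGuarded σ χ × LogEquiv σ χ Φ) (Flipped-sym F) Ψ∀
       (AllRestricted-dual restricted , dual-LogEquiv Ψ∀≡¬Φ))
  where
  Φ : Sentence σ
  Φ = bindSO σ P Φ*
  F : Flipped P (flipPrefix P)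
  F = Flipped-flipPrefix P
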